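{- Let $d$ be a positive integer and let $S\subseteq\mathbb{N}^d$ be an equivariant GNS. Then: (1) for $\mathbf{x}\in S$, $\mathbf{x}$ is a minimal generator of $S$ if and only if $S\setminus\mathrm{orb}(\mathbf{x})$ is an equivariant GNS; (2) if $\mathbf{x}$ is a maximal element of $\operatorname{H}(S)$ with respect to the natural partial order $\leq$ of $\mathbb{N}^d$, then $S\cup\mathrm{orb}(\mathbf{x})$ is an equivariant GNS.
   Context: A generalized numerical semigroup (GNS) in $\mathbb{N}^d$ is a submonoid $S$ of $(\mathbb{N}^d,+)$ with $\operatorname{H}(S)=\mathbb{N}^d\setminus S$ finite. Minimal generators of $S$ are the elements of $S^*\setminus(S^*+S^*)$, $S^*=S\setminus\{\mathbf{0}\}$. The natural partial order: $\mathbf{a}\leq\mathbf{b}$ iff $\mathbf{b}-\mathbf{a}\in\mathbb{N}^d$. $\operatorname{P}_d$ is the set of permutations of $\{1,\ldots,d\}$, acting on $\mathbb{N}^d$ by $\sigma(\sum x_i\mathbf{e}_i)=\sum x_i\mathbf{e}_{\sigma(i)}$ ($\mathbf{e}_i$ standard basis), and on subsets elementwise; $\mathrm{orb}(\mathbf{x})=\{\sigma(\mathbf{x})\mid\sigma\in\operatorname{P}_d\}$. $S$ is equivariant if $\sigma(S)=S$ for all $\sigma\in\operatorname{P}_d$. -}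

module Defs where

open import Data.Nat using (ℕ; _≤_)
open import Data.Fin using (Fin)
open import Data.Fin.Permutation using (Permutation′; _⟨$⟩ˡ_)
open import Data.Vec using (Vec; lookup; tabulate; zipWith; replicate)
open import Data.Vec.Relation.Binary.Pointwise.Inductive using (Pointwise)
open import Data.List using (List)
open import Data.List.Membership.Propositional using (_∈_; _∉_)
open import Data.Product using (Σ; ∃; _×_; _,_)
open import Relation.Binary.PropositionalEquality using (_≡_; _≢_)
open import Relation.Nullary using (¬_)
open import Level using (0ℓ; suc)

Pt : ℕ → Set
Pt d = Vec ℕ d

𝟎 : ∀ {d} → Pt d
𝟎 {d} = replicate d 0

_⊕_ : ∀ {d} → Pt d → Pt d → Pt d
_⊕_ = zipWith Data.Nat._+_

_≼_ : ∀ {d} → Pt d → Pt d → Set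
_≼_ = Pointwise _≤_

_≺_ : ∀ {d} → Pt d → Pt d → Set
a ≺ b = (a ≼ b) × (a ≢ b)

Subset : ℕ → Set₁
Subset d = Pt d → Set

-- action of σ : σ(Σ x_i e_i) = Σ x_i e_{σ(i)}, i.e. (σ x)_j = x_{σ⁻¹ j}
act : ∀ {d} → Permutation′ d → Pt d → Pt d
act σ x = tabulate (λ j → lookup x (σ ⟨$⟩ˡ j))

InOrb : ∀ {d} → Pt d → Subset d
InOrb x y = Σ (Permutation′ _) (λ σ → y ≡ act σ x)

_∖orb_ : ∀ {d} → Subset d → Pt d → Subset d
(S ∖orb x) y = S y × ¬ InOrb x y

_∪orb_ : ∀ {d} → Subset d → Pt d → Subset d
(S ∪orb x) y = Data.Sum._⊎_ (S y) (InOrb x y)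
  where import Data.Sum

IsSubmonoid : ∀ {d} → Subset d → Set
IsSubmonoid S = S 𝟎 × (∀ a b → S a → S b → S (a ⊕ b))

FiniteComplement : ∀ {d} → Subset d → Set
FiniteComplement {d} S =
  Σ (List (Pt d)) (λ L → ∀ y → (y ∈ L → ¬ S y) × (y ∉ L → S y))

IsGNS : ∀ {d} → Subset d → Set
IsGNS S = IsSubmonoid S × FiniteComplement S

IsEquivariant : ∀ {d} → Subset d → Set
IsEquivariant {d} S = ∀ (σ : Permutation′ d) y → (S y → S (act σ y)) × (S (act σ y) → S y)

IsEquivariantGNS : ∀ {d} → Subset d → Set
IsEquivariantGNS S = IsGNS S × IsEquivariant S

IsMinimalGenerator : ∀ {d} → Subset d → Pt d → Set
IsMinimalGenerator S x =
  S x × x ≢ 𝟎 ×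
  ¬ (∃ λ a → ∃ λ b → S a × a ≢ 𝟎 × S b × b ≢ 𝟎 × x ≡ a ⊕ b)

IsMaximalGap : ∀ {d} → Subset d → Pt d → Set
IsMaximalGap S x = ¬ S x × (∀ y → x ≺ y → ¬ ¬ S y)

{-# OPTIONS --safe #-}

-- A permutation acts on ℕ^d as an additive bijection preserving 𝟎 and the
-- coordinate sum, so a summand a of a ⊕ b with b ≢ 𝟎 never lies in the orbit
-- of a ⊕ b; orbits are finite since the permutations can be listed.  Removing orb x keeps S closed under ⊕
-- exactly when no element of orb x splits as a sum of two nonzero elements of
-- S, i.e. (by equivariance) when x is a minimal generator.  Adding the orbit
-- of a maximal gap x keeps S closed because y ⊕ z ∈ S for y ∈ orb x and
-- z ≢ 𝟎: moved back by the permutation, it lies strictly above x.  Membership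
-- in S is decidable, its complement being a finite list; this turns the
-- double-negated maximality of a gap into membership, and keeps the new
-- complements finite lists.

module Submission where

open import Defs
open import Data.Empty using (⊥-elim)
open import Data.Fin using (Fin; zero; suc; punchIn)
open import Data.Fin.Permutation
  using (Permutation′; _⟨$⟩ˡ_; _⟨$⟩ʳ_; _≈_; flip; _∘ₚ_; insert; remove; insert-remove; insert-punchIn; inverseˡ)
import Data.Fin.Permutation as Perm
open import Data.List using (List; []; _∷_; map; concat; allFin; _++_; filter)
open import Data.List.Membership.Propositional using (_∈_; _∉_)
open import Data.List.Membership.Propositional.Properties
  using (∈-map⁺; ∈-map⁻; ∈-++⁺ˡ; ∈-++⁺ʳ; ∈-++⁻; ∈-filter⁺; ∈-filter⁻; ∈-concat⁺′; ∈-allFin)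
import Data.List.Membership.DecPropositional as DecMembership
open import Data.List.Relation.Unary.Any using (here)
open import Data.Nat using (ℕ; suc; zero; _+_)
open import Data.Nat.Properties
  using (+-identityˡ; +-identityʳ; +-comm; +-cancelˡ-≡; m+n≡0⇒m≡0; m+n≡0⇒n≡0; m≤m+n; +-0-commutativeMonoid)
open import Algebra.Properties.CommutativeMonoid.Sum +-0-commutativeMonoid
  using (sum; sum-permute; sum-cong-≗; ∑-distrib-+)
open import Data.Product using (_×_; _,_; proj₁; proj₂; ∃)
import Data.Product as Product
open import Data.Sum using (inj₁; inj₂; [_,_]′)
import Data.Sum as Sum
open import Data.Vec using ([]; _∷_; lookup)
open import Data.Vec.Properties
  using (lookup∘tabulate; tabulate-cong; lookup-zipWith; lookup-replicate; zipWith-comm; zipWith-identityˡ; ≡-dec)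
open import Data.Vec.Relation.Binary.Pointwise.Extensional using (ext; Pointwise-≡⇒≡)
open import Data.Vec.Relation.Binary.Pointwise.Inductive using ([]; _∷_)
open import Function using (_∘_; _$_)
open import Function.Bundles using (_⇔_; mk⇔; Equivalence)
open Equivalence using (to; from)
open import Relation.Binary.PropositionalEquality
  using (_≡_; _≢_; refl; sym; trans; cong; cong₂; subst; module ≡-Reasoning)
open import Relation.Nullary using (¬_; Dec; yes; no; ¬?; Stable)
import Relation.Nullary.Decidable as Dec
open import Relation.Nullary.Decidable using (decidable-stable)

private
  variable
    d : ℕ
    S : Subset d
    x y : Pt d

_≟_ : (a b : Pt d) → Dec (a ≡ b)
_≟_ = ≡-dec Data.Nat._≟_

lookup-extensionality : {a b : Pt d} → (∀ i → lookup a i ≡ lookup b i) → a ≡ b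
lookup-extensionality = Pointwise-≡⇒≡ ∘ ext

lookup-⊕ : (a b : Pt d) (i : Fin d) → lookup (a ⊕ b) i ≡ lookup a i + lookup b i
lookup-⊕ a b i = lookup-zipWith _+_ i a b

⊕-comm : (a b : Pt d) → a ⊕ b ≡ b ⊕ a
⊕-comm = zipWith-comm +-comm

⊕-identityˡ : (a : Pt d) → 𝟎 ⊕ a ≡ a
⊕-identityˡ = zipWith-identityˡ +-identityˡ

⊕-identityʳ : (a : Pt d) → a ⊕ 𝟎 ≡ a
⊕-identityʳ a = trans (⊕-comm a 𝟎) (⊕-identityˡ a)

≼-⊕ : (a b : Pt d) → a ≼ (a ⊕ b)
≼-⊕ []      []      = []
≼-⊕ (m ∷ a) (n ∷ b) = m≤m+n m n ∷ ≼-⊕ a b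

total : Pt d → ℕ
total a = sum (lookup a)

total-⊕ : (a b : Pt d) → total (a ⊕ b) ≡ total a + total b
total-⊕ a b = trans (sum-cong-≗ (lookup-⊕ a b)) (∑-distrib-+ (lookup a) (lookup b))

total≡0⇒≡𝟎 : (a : Pt d) → total a ≡ 0 → a ≡ 𝟎
total≡0⇒≡𝟎 []      _ = refl
total≡0⇒≡𝟎 (m ∷ a) e = cong₂ _∷_ (m+n≡0⇒m≡0 m e) (total≡0⇒≡𝟎 a (m+n≡0⇒n≡0 m e))

total-⊕≡⇒≡𝟎 : (a b : Pt d) → total (a ⊕ b) ≡ total a → b ≡ 𝟎
total-⊕≡⇒≡𝟎 a b e = total≡0⇒≡𝟎 b $ +-cancelˡ-≡ (total a) (total b) 0 $ begin
  total a + total b  ≡⟨ total-⊕ a b ⟨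
  total (a ⊕ b)      ≡⟨ e ⟩
  total a            ≡⟨ +-identityʳ (total a) ⟨
  total a + 0        ∎
  where open ≡-Reasoning

lookup-act : (σ : Permutation′ d) (a : Pt d) (i : Fin d) → lookup (act σ a) i ≡ lookup a (σ ⟨$⟩ˡ i)
lookup-act σ a = lookup∘tabulate (lookup a ∘ (σ ⟨$⟩ˡ_))

act-⊕ : (σ : Permutation′ d) (a b : Pt d) → act σ (a ⊕ b) ≡ act σ a ⊕ act σ b
act-⊕ σ a b = lookup-extensionality λ i → begin
  lookup (act σ (a ⊕ b)) i                      ≡⟨ lookup-act σ (a ⊕ b) i ⟩
  lookup (a ⊕ b) (σ ⟨$⟩ˡ i)                     ≡⟨ lookup-⊕ a b (σ ⟨$⟩ˡ i) ⟩
  lookup a (σ ⟨$⟩ˡ i) + lookup b (σ ⟨$⟩ˡ i)     ≡⟨ cong₂ _+_ (lookup-act σ a i) (lookup-act σ b i) ⟨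
  lookup (act σ a) i + lookup (act σ b) i       ≡⟨ lookup-⊕ (act σ a) (act σ b) i ⟨
  lookup (act σ a ⊕ act σ b) i                  ∎
  where open ≡-Reasoning

act-𝟎 : (σ : Permutation′ d) → act σ 𝟎 ≡ 𝟎
act-𝟎 {d} σ = lookup-extensionality λ i →
  trans (lookup-act σ 𝟎 i) (trans (lookup-replicate {n = d} (σ ⟨$⟩ˡ i) 0) (sym (lookup-replicate i 0)))

act-id : (a : Pt d) → act Perm.id a ≡ a
act-id a = lookup-extensionality (lookup-act Perm.id a)

act-∘ₚ : (σ τ : Permutation′ d) (a : Pt d) → act τ (act σ a) ≡ act (σ ∘ₚ τ) a
act-∘ₚ σ τ a = tabulate-cong λ i → lookup-act σ a (τ ⟨$⟩ˡ i)

act-flip : (σ : Permutation′ d) (a : Pt d) → act (flip σ) (act σ a) ≡ a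
act-flip σ a = lookup-extensionality λ i →
  trans (lookup-act (flip σ) (act σ a) i) (trans (lookup-act σ a (σ ⟨$⟩ʳ i)) (cong (lookup a) (inverseˡ σ)))

act-cong : {σ τ : Permutation′ d} → (∀ i → σ ⟨$⟩ˡ i ≡ τ ⟨$⟩ˡ i) → (a : Pt d) → act σ a ≡ act τ a
act-cong σ≗τ a = tabulate-cong (cong (lookup a) ∘ σ≗τ)

act≡𝟎⇒≡𝟎 : (σ : Permutation′ d) (a : Pt d) → act σ a ≡ 𝟎 → a ≡ 𝟎
act≡𝟎⇒≡𝟎 σ a e = trans (sym (act-flip σ a)) (trans (cong (act (flip σ)) e) (act-𝟎 (flip σ)))

total-act : (σ : Permutation′ d) (a : Pt d) → total (act σ a) ≡ total a
total-act σ a = trans (sum-cong-≗ (lookup-act σ a)) (sym (sum-permute (lookup a) (flip σ)))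

InOrb-refl : (a : Pt d) → InOrb a a
InOrb-refl a = Perm.id , sym (act-id a)

InOrb-act : (σ : Permutation′ d) → InOrb x y → InOrb x (act σ y)
InOrb-act {x = x} σ (τ , refl) = τ ∘ₚ σ , act-∘ₚ τ σ x

InOrb-isEquivariant : (x : Pt d) → IsEquivariant (InOrb x)
InOrb-isEquivariant x σ y =
  InOrb-act {x = x} σ , subst (InOrb x) (act-flip σ y) ∘ InOrb-act {x = x} (flip σ)

InOrb-𝟎 : InOrb x 𝟎 → x ≡ 𝟎
InOrb-𝟎 {x = x} (σ , 𝟎≡σx) = act≡𝟎⇒≡𝟎 σ x (sym 𝟎≡σx)

InOrb-⊕⇒≡𝟎 : (a b : Pt d) → InOrb (a ⊕ b) a → b ≡ 𝟎
InOrb-⊕⇒≡𝟎 a b (σ , e) = total-⊕≡⇒≡𝟎 a b (trans (sym (total-act σ (a ⊕ b))) (cong total (sym e)))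

permutations : (n : ℕ) → List (Permutation′ n)
permutations zero    = Perm.id ∷ []
permutations (suc n) = concat (map (λ j → map (insert zero j) (permutations n)) (allFin (suc n)))

-- Permutations are functions, so the enumeration is complete only up to _≈_.
permutations-complete : (n : ℕ) (π : Permutation′ n) → ∃ λ τ → τ ∈ permutations n × π ≈ τ
permutations-complete zero    π = Perm.id , here refl , λ ()
permutations-complete (suc n) π with permutations-complete n (remove zero π)
... | τ , τ∈ , π₀≈τ = insert zero j τ , ∈-permutations , π≈insert
  where
  j = π ⟨$⟩ʳ zero
  ∈-permutations : insert zero j τ ∈ permutations (suc n)
  ∈-permutations = ∈-concat⁺′ (∈-map⁺ (insert zero j) τ∈)
                              (∈-map⁺ (λ k → map (insert zero k) (permutations n)) (∈-allFin j))
  π≈insert : π ≈ insert zero j τ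
  π≈insert zero    = sym (insert-remove zero π zero)
  π≈insert (suc k) = begin
    π ⟨$⟩ʳ suc k                              ≡⟨ insert-remove zero π (suc k) ⟨
    insert zero j (remove zero π) ⟨$⟩ʳ suc k  ≡⟨ insert-punchIn zero j (remove zero π) k ⟩
    punchIn j (remove zero π ⟨$⟩ʳ k)          ≡⟨ cong (punchIn j) (π₀≈τ k) ⟩
    punchIn j (τ ⟨$⟩ʳ k)                      ≡⟨ insert-punchIn zero j τ k ⟨
    insert zero j τ ⟨$⟩ʳ suc k                ∎
    where open ≡-Reasoning

-- act reads σ through _⟨$⟩ˡ_ while _≈_ compares _⟨$⟩ʳ_, hence the flip.
orbit : Pt d → List (Pt d)
orbit {d} x = map (λ τ → act (flip τ) x) (permutations d)

∈-orbit⇔InOrb : (x y : Pt d) → y ∈ orbit x ⇔ InOrb x y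
∈-orbit⇔InOrb {d} x y = mk⇔ sound complete
  where
  sound : y ∈ orbit x → InOrb x y
  sound y∈ with ∈-map⁻ (λ τ → act (flip τ) x) y∈
  ... | τ , _ , e = flip τ , e
  complete : InOrb x y → y ∈ orbit x
  complete (σ , y≡σx) with permutations-complete d (flip σ)
  ... | τ , τ∈ , σ⁻¹≈τ = subst (_∈ orbit x) τ⁻¹x≡y (∈-map⁺ (λ τ → act (flip τ) x) τ∈)
    where
    τ⁻¹x≡y : act (flip τ) x ≡ y
    τ⁻¹x≡y = trans (act-cong {σ = flip τ} {τ = σ} (λ i → sym (σ⁻¹≈τ i)) x) (sym y≡σx)

_∈?_ : (y : Pt d) (L : List (Pt d)) → Dec (y ∈ L)
_∈?_ = DecMembership._∈?_ _≟_

InOrb? : (x y : Pt d) → Dec (InOrb x y)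
InOrb? x y = Dec.map (∈-orbit⇔InOrb x y) (y ∈? orbit x)

finiteComplement⇒decidable : FiniteComplement S → (y : Pt d) → Dec (S y)
finiteComplement⇒decidable (L , L≡H) y with y ∈? L
... | yes y∈L = no (proj₁ (L≡H y) y∈L)
... | no  y∉L = yes (proj₂ (L≡H y) y∉L)

∖orb-finiteComplement : (x : Pt d) → FiniteComplement S → FiniteComplement (S ∖orb x)
∖orb-finiteComplement {S = S} x (L , L≡H) = L ++ orbit x , λ y → gap y , member y
  where
  gap : ∀ y → y ∈ L ++ orbit x → ¬ (S ∖orb x) y
  gap y y∈ (Sy , y∉orb) with ∈-++⁻ L y∈
  ... | inj₁ y∈L   = proj₁ (L≡H y) y∈L Sy
  ... | inj₂ y∈orb = y∉orb (to (∈-orbit⇔InOrb x y) y∈orb)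
  member : ∀ y → y ∉ L ++ orbit x → (S ∖orb x) y
  member y y∉ = proj₂ (L≡H y) (y∉ ∘ ∈-++⁺ˡ) , y∉ ∘ ∈-++⁺ʳ L ∘ from (∈-orbit⇔InOrb x y)

∪orb-finiteComplement : (x : Pt d) → FiniteComplement S → FiniteComplement (S ∪orb x)
∪orb-finiteComplement {S = S} x (L , L≡H) = filter (¬? ∘ InOrb? x) L , λ y → gap y , member y
  where
  gap : ∀ y → y ∈ filter (¬? ∘ InOrb? x) L → ¬ (S ∪orb x) y
  gap y y∈ with ∈-filter⁻ (¬? ∘ InOrb? x) y∈
  ... | y∈L , y∉orb = [ proj₁ (L≡H y) y∈L , y∉orb ]′
  member : ∀ y → y ∉ filter (¬? ∘ InOrb? x) L → (S ∪orb x) y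
  member y y∉ with y ∈? L | InOrb? x y
  ... | no  y∉L | _         = inj₁ (proj₂ (L≡H y) y∉L)
  ... | yes _   | yes y∈orb = inj₂ y∈orb
  ... | yes y∈L | no  y∉orb = ⊥-elim (y∉ (∈-filter⁺ (¬? ∘ InOrb? x) y∈L y∉orb))

∖orb-isEquivariant : (x : Pt d) → IsEquivariant S → IsEquivariant (S ∖orb x)
∖orb-isEquivariant x S-eq σ y =
  Product.map (proj₁ (S-eq σ y)) (_∘ proj₂ (InOrb-isEquivariant x σ y)) ,
  Product.map (proj₂ (S-eq σ y)) (_∘ proj₁ (InOrb-isEquivariant x σ y))

∪orb-isEquivariant : (x : Pt d) → IsEquivariant S → IsEquivariant (S ∪orb x)
∪orb-isEquivariant x S-eq σ y =
  Sum.map (proj₁ (S-eq σ y)) (proj₁ (InOrb-isEquivariant x σ y)) ,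
  Sum.map (proj₂ (S-eq σ y)) (proj₂ (InOrb-isEquivariant x σ y))

Decomposable : Subset d → Pt d → Set
Decomposable S x = ∃ λ a → ∃ λ b → S a × a ≢ 𝟎 × S b × b ≢ 𝟎 × x ≡ a ⊕ b

IsMinimalGenerator-act : IsEquivariant S → (σ : Permutation′ d) →
                         IsMinimalGenerator S x → IsMinimalGenerator S (act σ x)
IsMinimalGenerator-act {S = S} {x = x} S-eq σ (Sx , x≢𝟎 , indecomposable) =
  proj₁ (S-eq σ x) Sx , x≢𝟎 ∘ act≡𝟎⇒≡𝟎 σ x , σx-indecomposable
  where
  σ⁻¹ = flip σ
  σx-indecomposable : ¬ Decomposable S (act σ x)
  σx-indecomposable (a , b , Sa , a≢𝟎 , Sb , b≢𝟎 , σx≡a⊕b) = indecomposable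
    ( act σ⁻¹ a , act σ⁻¹ b
    , proj₁ (S-eq σ⁻¹ a) Sa , a≢𝟎 ∘ act≡𝟎⇒≡𝟎 σ⁻¹ a
    , proj₁ (S-eq σ⁻¹ b) Sb , b≢𝟎 ∘ act≡𝟎⇒≡𝟎 σ⁻¹ b
    , trans (sym (act-flip σ x)) (trans (cong (act σ⁻¹) σx≡a⊕b) (act-⊕ σ⁻¹ a b)))

minimalGenerator⇒∖orb-isSubmonoid : IsSubmonoid S → IsEquivariant S →
                                    IsMinimalGenerator S x → IsSubmonoid (S ∖orb x)
minimalGenerator⇒∖orb-isSubmonoid {S = S} {x = x} (S𝟎 , S-⊕) S-eq x-gen@(_ , x≢𝟎 , _) =
  (S𝟎 , x≢𝟎 ∘ InOrb-𝟎) , closed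
  where
  closed : ∀ a b → (S ∖orb x) a → (S ∖orb x) b → (S ∖orb x) (a ⊕ b)
  closed a b (Sa , a∉orb) (Sb , b∉orb) = S-⊕ a b Sa Sb , a⊕b∉orb
    where
    a⊕b∉orb : ¬ InOrb x (a ⊕ b)
    a⊕b∉orb a⊕b∈orb@(σ , a⊕b≡σx) =
      proj₂ (proj₂ (subst (IsMinimalGenerator S) (sym a⊕b≡σx) (IsMinimalGenerator-act S-eq σ x-gen)))
        (a , b , Sa , a≢𝟎 , Sb , b≢𝟎 , refl)
      where
      a≢𝟎 : a ≢ 𝟎
      a≢𝟎 a≡𝟎 = b∉orb (subst (InOrb x) (trans (cong (_⊕ b) a≡𝟎) (⊕-identityˡ b)) a⊕b∈orb)
      b≢𝟎 : b ≢ 𝟎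
      b≢𝟎 b≡𝟎 = a∉orb (subst (InOrb x) (trans (cong (a ⊕_) b≡𝟎) (⊕-identityʳ a)) a⊕b∈orb)

∖orb-isSubmonoid⇒minimalGenerator : S x → IsSubmonoid (S ∖orb x) → IsMinimalGenerator S x
∖orb-isSubmonoid⇒minimalGenerator {S = S} {x = x} Sx ((_ , 𝟎∉orb) , closed) =
  Sx , x≢𝟎 , indecomposable
  where
  x≢𝟎 : x ≢ 𝟎
  x≢𝟎 x≡𝟎 = 𝟎∉orb (subst (InOrb x) x≡𝟎 (InOrb-refl x))
  indecomposable : ¬ Decomposable S x
  indecomposable (a , b , Sa , a≢𝟎 , Sb , b≢𝟎 , x≡a⊕b) =
    proj₂ (closed a b (Sa , a∉orb) (Sb , b∉orb)) (subst (InOrb x) x≡a⊕b (InOrb-refl x))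
    where
    a∉orb : ¬ InOrb x a
    a∉orb = b≢𝟎 ∘ InOrb-⊕⇒≡𝟎 a b ∘ subst (λ z → InOrb z a) x≡a⊕b
    b∉orb : ¬ InOrb x b
    b∉orb = a≢𝟎 ∘ InOrb-⊕⇒≡𝟎 b a ∘ subst (λ z → InOrb z b) (trans x≡a⊕b (⊕-comm a b))

maximalGap-⊕ : (∀ y → Stable (S y)) → IsMaximalGap S x → (z : Pt d) → z ≢ 𝟎 → S (x ⊕ z)
maximalGap-⊕ {x = x} S-stable (_ , above-x) z z≢𝟎 =
  S-stable (x ⊕ z) (above-x (x ⊕ z) (≼-⊕ x z , z≢𝟎 ∘ total-⊕≡⇒≡𝟎 x z ∘ cong total ∘ sym))

InOrb-maximalGap-⊕ : IsEquivariant S → (∀ y → Stable (S y)) → IsMaximalGap S x →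
                     InOrb x y → (z : Pt d) → z ≢ 𝟎 → S (y ⊕ z)
InOrb-maximalGap-⊕ {S = S} {x = x} S-eq S-stable x-gap (σ , refl) z z≢𝟎 =
  proj₂ (S-eq σ⁻¹ (act σ x ⊕ z))
        (subst S (sym moved-back) (maximalGap-⊕ S-stable x-gap (act σ⁻¹ z) σ⁻¹z≢𝟎))
  where
  σ⁻¹ = flip σ
  σ⁻¹z≢𝟎 : act σ⁻¹ z ≢ 𝟎
  σ⁻¹z≢𝟎 = z≢𝟎 ∘ act≡𝟎⇒≡𝟎 σ⁻¹ z
  moved-back : act σ⁻¹ (act σ x ⊕ z) ≡ x ⊕ act σ⁻¹ z
  moved-back = trans (act-⊕ σ⁻¹ (act σ x) z) (cong (_⊕ act σ⁻¹ z) (act-flip σ x))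

maximalGap⇒∪orb-isSubmonoid : IsSubmonoid S → IsEquivariant S → (∀ y → Stable (S y)) →
                              IsMaximalGap S x → IsSubmonoid (S ∪orb x)
maximalGap⇒∪orb-isSubmonoid {S = S} {x = x} (S𝟎 , S-⊕) S-eq S-stable x-gap = inj₁ S𝟎 , closed
  where
  orbit-⊕ : ∀ a b → InOrb x a → (S ∪orb x) (a ⊕ b)
  orbit-⊕ a b a∈orb with b ≟ 𝟎
  ... | yes b≡𝟎 = inj₂ (subst (InOrb x) (trans (sym (⊕-identityʳ a)) (cong (a ⊕_) (sym b≡𝟎))) a∈orb)
  ... | no  b≢𝟎 = inj₁ (InOrb-maximalGap-⊕ S-eq S-stable x-gap a∈orb b b≢𝟎)
  closed : ∀ a b → (S ∪orb x) a → (S ∪orb x) b → (S ∪orb x) (a ⊕ b)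
  closed a b (inj₁ Sa)     (inj₁ Sb)     = inj₁ (S-⊕ a b Sa Sb)
  closed a b (inj₂ a∈orb)  _             = orbit-⊕ a b a∈orb
  closed a b (inj₁ _)      (inj₂ b∈orb)  = subst (S ∪orb x) (⊕-comm b a) (orbit-⊕ b a b∈orb)

mainTheorem8 : ∀ (n : ℕ) (S : Subset (suc n)) → IsEquivariantGNS S →
    (∀ x → S x → (IsMinimalGenerator S x ⇔ IsEquivariantGNS (S ∖orb x)))
    × (∀ x → IsMaximalGap S x → IsEquivariantGNS (S ∪orb x))
mainTheorem8 n S ((S-monoid , S-fin) , S-eq) = part₁ , part₂
  where
  part₁ : ∀ x → S x → (IsMinimalGenerator S x ⇔ IsEquivariantGNS (S ∖orb x))
  part₁ x Sx = mk⇔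
    (λ x-gen → (minimalGenerator⇒∖orb-isSubmonoid S-monoid S-eq x-gen , ∖orb-finiteComplement x S-fin)
             , ∖orb-isEquivariant x S-eq)
    (λ ((S∖orb-monoid , _) , _) → ∖orb-isSubmonoid⇒minimalGenerator Sx S∖orb-monoid)
  part₂ : ∀ x → IsMaximalGap S x → IsEquivariantGNS (S ∪orb x)
  part₂ x x-gap =
    (maximalGap⇒∪orb-isSubmonoid S-monoid S-eq S-stable x-gap , ∪orb-finiteComplement x S-fin)
    , ∪orb-isEquivariant x S-eq
    where
    S-stable : ∀ y → Stable (S y)
    S-stable y = decidable-stable (finiteComplement⇒decidable S-fin y)
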